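{- Let $G=(V,E)$ be a finite simple graph with $|V|\ge \gamma(G)+2$. If $b(\mathcal{MB}(G))\le 2$, then $Sb_2(G)=b(G)+b(\mathcal{MB}(G))$.
   Context: For a graph $G=(V,E)$, $\gamma(G)$ is its domination number: the minimum size of a set $D\subseteq V$ such that every vertex is in $D$ or adjacent to a vertex of $D$. The bondage number $b(G)$ is the minimum size of a set $\mathcal{E}\subseteq E$ with $\gamma(G-\mathcal{E})>\gamma(G)$; such a set of minimum size is a minimum bondage set. For a positive integer $k$, $Sb_k(G)$ (the $k$-synchronous bondage number) is the minimum size of a set $\mathcal{E}\subseteq E$ with $\gamma(G-\mathcal{E})=\gamma(G)+k$. $\mathcal{MB}(G)$ denotes the set of all graphs $G-\mathcal{E}$ where $\mathcal{E}$ is a minimum bondage set of $G$, and for a set of graphs $\mathcal{G}$, $b(\mathcal{G})=\min\{b(G'):G'\in\mathcal{G}\}$. -}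

module Defs where

open import Data.Nat using (ℕ; zero; suc; _+_; _≤_; _<_)
open import Data.Bool using (Bool; true; false; _∧_; not; if_then_else_)
open import Data.Fin using (Fin; toℕ)
open import Data.Fin.Subset using (Subset; _∈_; ∣_∣)
open import Data.List using (List; map; allFin)
open import Data.Nat.ListAction using (sum)
open import Data.Nat using (_<ᵇ_)
open import Data.Product using (Σ; ∃; _×_; _,_)
open import Data.Sum using (_⊎_)
open import Relation.Binary.PropositionalEquality using (_≡_; refl; cong₂)

record Graph (n : ℕ) : Set where
  field
    adj    : Fin n → Fin n → Bool
    sym    : ∀ i j → adj i j ≡ adj j i
    irrefl : ∀ i → adj i i ≡ false
open Graph public

edgeCount : ∀ {n} → Graph n → ℕ
edgeCount {n} G =
  sum (map (λ i → sum (map (λ j → if (toℕ i <ᵇ toℕ j) ∧ adj G i j then 1 else 0)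
                           (allFin n)))
           (allFin n))

-- A set of edges of G is represented as a graph F on the same vertex set
-- whose edges are all edges of G.  Its size is edgeCount F.
_⊆E_ : ∀ {n} → Graph n → Graph n → Set
F ⊆E G = ∀ i j → adj F i j ≡ true → adj G i j ≡ true

_─_ : ∀ {n} → Graph n → Graph n → Graph n
adj (G ─ F) i j = adj G i j ∧ not (adj F i j)
sym (G ─ F) i j = cong₂ (λ a b → a ∧ not b) (sym G i j) (sym F i j)
irrefl (G ─ F) i rewrite irrefl G i = refl

Dominating : ∀ {n} → Graph n → Subset n → Set
Dominating {n} G D = ∀ v → v ∈ D ⊎ (∃ λ (u : Fin n) → u ∈ D × adj G u v ≡ true)

IsDomNum : ∀ {n} → Graph n → ℕ → Set
IsDomNum {n} G k =
  (∃ λ (D : Subset n) → Dominating G D × ∣ D ∣ ≡ k)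
  × (∀ (D : Subset n) → Dominating G D → k ≤ ∣ D ∣)

IsBondageSet : ∀ {n} → Graph n → Graph n → Set
IsBondageSet G F =
  F ⊆E G × (∃ λ k → ∃ λ k' → IsDomNum G k × IsDomNum (G ─ F) k' × k < k')

IsBondageNum : ∀ {n} → Graph n → ℕ → Set
IsBondageNum {n} G β =
  (∃ λ (F : Graph n) → IsBondageSet G F × edgeCount F ≡ β)
  × (∀ (F : Graph n) → IsBondageSet G F → β ≤ edgeCount F)

IsMinBondageSet : ∀ {n} → Graph n → Graph n → Set
IsMinBondageSet {n} G F =
  IsBondageSet G F × (∀ (F' : Graph n) → IsBondageSet G F' → edgeCount F ≤ edgeCount F')

-- b(MB(G)) = c, where MB(G) = { G - F : F a minimum bondage set of G }
-- and b(MB(G)) = min { b(G') : G' ∈ MB(G) } (over those G' whose bondage number exists).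
IsBondageNumMB : ∀ {n} → Graph n → ℕ → Set
IsBondageNumMB {n} G c =
  (∃ λ (F : Graph n) → IsMinBondageSet G F × IsBondageNum (G ─ F) c)
  × (∀ (F : Graph n) → IsMinBondageSet G F → ∀ c' → IsBondageNum (G ─ F) c' → c ≤ c')

IsSyncBondageSet : ∀ {n} → ℕ → Graph n → Graph n → Set
IsSyncBondageSet k G F =
  F ⊆E G × (∃ λ g → ∃ λ g' → IsDomNum G g × IsDomNum (G ─ F) g' × g' ≡ g + k)

IsSyncBondageNum : ∀ {n} → ℕ → Graph n → ℕ → Set
IsSyncBondageNum {n} k G s =
  (∃ λ (F : Graph n) → IsSyncBondageSet k G F × edgeCount F ≡ s)
  × (∀ (F : Graph n) → IsSyncBondageSet k G F → s ≤ edgeCount F)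

{-# OPTIONS --safe #-}
-- Deleting a single edge raises the domination number by at most one.  So a minimum
-- bondage set F raises γ by exactly one, and F together with a minimum bondage set of
-- G ─ F raises it by two: Sb₂ ≤ b + b(MB).  Conversely, dropping one edge from a set
-- raising γ by two leaves a bondage set F₀.  If F₀ is not minimum, the set has at least
-- b + 2 ≥ b + b(MB) edges; otherwise the dropped edge alone is a bondage set of G ─ F₀,
-- so b(MB) = 1 and the set has b + 1 edges.
module Submission where

open import Defs
open import Data.Nat using (ℕ; zero; suc; _+_; _≤_; _<_; _<ᵇ_; _≤?_; z≤n; s≤s; s≤s⁻¹; z<s)
open import Data.Nat.Properties hiding (_≟_)
open import Data.Nat.ListAction using (sum)
open import Data.Bool using (true; false; _∧_; _∨_; not; if_then_else_; T)
open import Data.Bool.Properties using (∧-zeroʳ; ∧-identityʳ; ∧-comm; ∨-comm; ∧-conicalˡ; ¬-not)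
  renaming (_≟_ to _≟ᵇ_)
open import Data.Fin as Fin using (Fin; zero; suc; toℕ; _≟_; punchIn)
import Data.Fin.Properties as Finₚ
open import Data.Fin.Subset using (Subset; _∈_; _⊆_; ∣_∣; _∪_; ⁅_⁆; ⊤; inside; outside)
open import Data.Fin.Subset.Properties
  using (_∈?_; ∈⊤; x∈⁅x⁆; ∣⁅x⁆∣≡1; x∈p∪q⁺; p⊆p∪q; anySubset?)
open import Data.Vec using ([]; _∷_)
open import Data.List using (map; allFin; tabulate)
open import Data.List.Properties using (map-tabulate)
open import Data.Product using (∃; ∃-syntax; _×_; _,_; proj₁; proj₂)
open import Data.Sum using (_⊎_; inj₁; inj₂)
open import Function using (_∘_; id)
open import Relation.Binary using (tri<; tri≈; tri>)
open import Relation.Nullary using (¬_; Dec; yes; no; does; contradiction)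
open import Relation.Nullary.Decidable using (_⊎-dec_; _×-dec_; dec-true; dec-false)
open import Relation.Binary.PropositionalEquality as ≡
  using (_≡_; refl; trans; cong; cong₂; subst; subst₂; module ≡-Reasoning)
open import Algebra.Properties.CommutativeMonoid.Sum +-0-commutativeMonoid
  using (sum-syntax; sum-cong-≗; ∑-distrib-+; sum-remove; sum-replicate-zero)

∑-allFin : ∀ {n} (f : Fin n → ℕ) → sum (map f (allFin n)) ≡ ∑[ i < n ] f i
∑-allFin {zero} f = refl
∑-allFin {suc n} f = cong (f zero +_) (begin
  sum (map f (tabulate suc))             ≡⟨ cong sum (map-tabulate suc f) ⟩
  sum (tabulate (f ∘ suc))               ≡⟨ cong sum (map-tabulate id (f ∘ suc)) ⟨
  sum (map (f ∘ suc) (allFin n))         ≡⟨ ∑-allFin (f ∘ suc) ⟩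
  ∑[ i < n ] f (suc i)                   ∎)
  where open ≡-Reasoning

δ : ∀ {n} → Fin n → Fin n → ℕ
δ u i = if does (i ≟ u) then 1 else 0

∑-δ : ∀ {n} (u : Fin n) → ∑[ i < n ] δ u i ≡ 1
∑-δ {suc n} u = begin
  ∑[ i < suc n ] δ u i                   ≡⟨ sum-remove {i = u} (δ u) ⟩
  δ u u + ∑[ j < n ] δ u (punchIn u j)   ≡⟨ cong₂ _+_ diagonal (sum-cong-≗ off-diagonal) ⟩
  1 + ∑[ j < n ] 0                       ≡⟨ cong (1 +_) (sum-replicate-zero n) ⟩
  1                                      ∎
  where
  open ≡-Reasoning
  diagonal : δ u u ≡ 1
  diagonal = cong (if_then 1 else 0) (dec-true (u ≟ u) refl)
  off-diagonal : ∀ j → δ u (punchIn u j) ≡ 0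
  off-diagonal j = cong (if_then 1 else 0) (dec-false (punchIn u j ≟ u) (Finₚ.punchInᵢ≢i u j))

-- Edge sets

_≈G_ : ∀ {n} → Graph n → Graph n → Set
A ≈G B = ∀ i j → adj A i j ≡ adj B i j

Disjoint : ∀ {n} → Graph n → Graph n → Set
Disjoint A B = ∀ i j → adj A i j ≡ true → adj B i j ≡ false

_∪G_ : ∀ {n} → Graph n → Graph n → Graph n
adj (A ∪G B) i j = adj A i j ∨ adj B i j
sym (A ∪G B) i j = cong₂ _∨_ (sym A i j) (sym B i j)
irrefl (A ∪G B) i rewrite irrefl A i | irrefl B i = refl

edge : ∀ {n} {u v : Fin n} → u Fin.< v → Graph n
adj (edge {u = u} {v} _) i j = (does (i ≟ u) ∧ does (j ≟ v)) ∨ (does (i ≟ v) ∧ does (j ≟ u))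
sym (edge {u = u} {v} _) i j =
  trans (∨-comm (does (i ≟ u) ∧ does (j ≟ v)) _)
        (cong₂ _∨_ (∧-comm (does (i ≟ v)) _) (∧-comm (does (i ≟ u)) _))
irrefl (edge {u = u} {v} u<v) i with i ≟ u | i ≟ v
... | yes refl | yes refl = contradiction refl (Finₚ.<⇒≢ u<v)
... | yes _    | no _     = refl
... | no _     | yes _    = refl
... | no _     | no _     = refl

edge-endpoints : ∀ {n} {u v : Fin n} (u<v : u Fin.< v) i j →
  adj (edge u<v) i j ≡ true → (i ≡ u × j ≡ v) ⊎ (i ≡ v × j ≡ u)
edge-endpoints {u = u} {v} _ i j ij∈e with i ≟ u | j ≟ v | i ≟ v | j ≟ u
... | yes i≡u | yes j≡v | _       | _       = inj₁ (i≡u , j≡v)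
... | _       | _       | yes i≡v | yes j≡u = inj₂ (i≡v , j≡u)
... | yes _   | no _    | no _    | _       = contradiction ij∈e λ ()
... | yes _   | no _    | yes _   | no _    = contradiction ij∈e λ ()
... | no _    | _       | no _    | _       = contradiction ij∈e λ ()
... | no _    | _       | yes _   | no _    = contradiction ij∈e λ ()

private
  ∧-not-∨ : ∀ x a b → (x ∧ not a) ∧ not b ≡ x ∧ not (a ∨ b)
  ∧-not-∨ false _     _ = refl
  ∧-not-∨ true  true  _ = refl
  ∧-not-∨ true  false _ = refl

  ∧-not-∨-cancel : ∀ f a → (a ≡ true → f ≡ true) → f ≡ (f ∧ not a) ∨ a
  ∧-not-∨-cancel true  true  _   = refl
  ∧-not-∨-cancel true  false _   = refl
  ∧-not-∨-cancel false false _   = refl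
  ∧-not-∨-cancel false true  a⇒f = contradiction (a⇒f refl) λ ()

  ∧-not-∧-not : ∀ x f a → (a ≡ true → f ≡ true) → x ∧ not f ≡ (x ∧ not (f ∧ not a)) ∧ not a
  ∧-not-∧-not false _     _     _   = refl
  ∧-not-∧-not true  true  true  _   = refl
  ∧-not-∧-not true  true  false _   = refl
  ∧-not-∧-not true  false false _   = refl
  ∧-not-∧-not true  false true  a⇒f = contradiction (a⇒f refl) λ ()

≈G⇒⊆E : ∀ {n} {A B : Graph n} → A ≈G B → A ⊆E B
≈G⇒⊆E A≈B i j ij∈A = trans (≡.sym (A≈B i j)) ij∈A

⊆E-trans : ∀ {n} {A B C : Graph n} → A ⊆E B → B ⊆E C → A ⊆E C
⊆E-trans A⊆B B⊆C i j = B⊆C i j ∘ A⊆B i j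

─-⊆E : ∀ {n} (G F : Graph n) → (G ─ F) ⊆E G
─-⊆E G F i j = ∧-conicalˡ (adj G i j) _

─-disjoint : ∀ {n} (F A : Graph n) → Disjoint (F ─ A) A
─-disjoint F A i j ij∈F─A with adj A i j
... | false = refl
... | true  = contradiction (trans (≡.sym (∧-zeroʳ (adj F i j))) ij∈F─A) λ ()

─-─≈─∪ : ∀ {n} (G F F′ : Graph n) → ((G ─ F) ─ F′) ≈G (G ─ (F ∪G F′))
─-─≈─∪ G F F′ i j = ∧-not-∨ (adj G i j) (adj F i j) (adj F′ i j)

∪-⊆E : ∀ {n} {G F F′ : Graph n} → F ⊆E G → F′ ⊆E (G ─ F) → (F ∪G F′) ⊆E G
∪-⊆E {G = G} {F} F⊆G F′⊆G─F i j ij∈F∪F′ with adj F i j in ij∈F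
... | true  = F⊆G i j ij∈F
... | false = ─-⊆E G F i j (F′⊆G─F i j ij∈F∪F′)

⊆E-─⇒disjoint : ∀ {n} {G F F′ : Graph n} → F′ ⊆E (G ─ F) → Disjoint F F′
⊆E-─⇒disjoint {G = G} {F} {F′} F′⊆G─F i j ij∈F with adj F′ i j in ij∈F′
... | false = refl
... | true  = contradiction
  (trans (≡.sym (trans (cong (λ b → adj G i j ∧ not b) ij∈F) (∧-zeroʳ (adj G i j))))
         (F′⊆G─F i j ij∈F′))
  λ ()

module _ {n} {F A : Graph n} (A⊆F : A ⊆E F) where

  ≈G-─∪ : F ≈G ((F ─ A) ∪G A)
  ≈G-─∪ i j = ∧-not-∨-cancel (adj F i j) (adj A i j) (A⊆F i j)

  ─≈─-─ : (G : Graph n) → (G ─ F) ≈G ((G ─ (F ─ A)) ─ A)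
  ─≈─-─ G i j = ∧-not-∧-not (adj G i j) (adj F i j) (adj A i j) (A⊆F i j)

  ⊆E-─-─ : ∀ {G} → F ⊆E G → A ⊆E (G ─ (F ─ A))
  ⊆E-─-─ F⊆G i j ij∈A
    rewrite ij∈A | A⊆F i j ij∈A | F⊆G i j (A⊆F i j ij∈A) = refl

-- Counting edges

edgeIndicator : ∀ {n} → Graph n → Fin n → Fin n → ℕ
edgeIndicator G i j = if (toℕ i <ᵇ toℕ j) ∧ adj G i j then 1 else 0

edgeCount-pointwise : ∀ {n} (G : Graph n) {f : Fin n → Fin n → ℕ} →
  (∀ i j → edgeIndicator G i j ≡ f i j) → edgeCount G ≡ ∑[ i < n ] ∑[ j < n ] f i j
edgeCount-pointwise {n} G G≗f = trans (∑-allFin (λ i → sum (map (edgeIndicator G i) (allFin n))))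
  (sum-cong-≗ λ i → trans (∑-allFin (edgeIndicator G i)) (sum-cong-≗ (G≗f i)))

edgeCount-cong : ∀ {n} {A B : Graph n} → A ≈G B → edgeCount A ≡ edgeCount B
edgeCount-cong {A = A} {B} A≈B = trans
  (edgeCount-pointwise A λ i j → cong (λ b → if (toℕ i <ᵇ toℕ j) ∧ b then 1 else 0) (A≈B i j))
  (≡.sym (edgeCount-pointwise B λ _ _ → refl))

edgeCount-∪ : ∀ {n} {A B : Graph n} → Disjoint A B → edgeCount (A ∪G B) ≡ edgeCount A + edgeCount B
edgeCount-∪ {n} {A} {B} A∩B≡∅ = begin
  edgeCount (A ∪G B)
    ≡⟨ edgeCount-pointwise (A ∪G B) (λ i j → indicator-∨ (toℕ i <ᵇ toℕ j) (A∩B≡∅ i j)) ⟩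
  ∑[ i < n ] ∑[ j < n ] (edgeIndicator A i j + edgeIndicator B i j)
    ≡⟨ sum-cong-≗ (λ i → ∑-distrib-+ (edgeIndicator A i) (edgeIndicator B i)) ⟩
  ∑[ i < n ] (∑[ j < n ] edgeIndicator A i j + ∑[ j < n ] edgeIndicator B i j)
    ≡⟨ ∑-distrib-+ (λ i → ∑[ j < n ] edgeIndicator A i j) (λ i → ∑[ j < n ] edgeIndicator B i j) ⟩
  ∑[ i < n ] ∑[ j < n ] edgeIndicator A i j + ∑[ i < n ] ∑[ j < n ] edgeIndicator B i j
    ≡⟨ cong₂ _+_ (edgeCount-pointwise A λ _ _ → refl) (edgeCount-pointwise B λ _ _ → refl) ⟨
  edgeCount A + edgeCount B ∎
  where
  open ≡-Reasoning
  indicator-∨ : ∀ l {a b} → (a ≡ true → b ≡ false) →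
    (if l ∧ (a ∨ b) then 1 else 0) ≡ (if l ∧ a then 1 else 0) + (if l ∧ b then 1 else 0)
  indicator-∨ false             _   = refl
  indicator-∨ true  {true}      a⇒¬b rewrite a⇒¬b refl = refl
  indicator-∨ true  {false} {b} _    with b
  ... | true  = refl
  ... | false = refl

private
  <ᵇ-true : ∀ {m n} → m < n → (m <ᵇ n) ≡ true
  <ᵇ-true {m} {n} m<n with m <ᵇ n | <⇒<ᵇ m<n
  ... | true | _ = refl

  <ᵇ-false : ∀ {m n} → n < m → (m <ᵇ n) ≡ false
  <ᵇ-false {m} {n} n<m with m <ᵇ n in m<ᵇn
  ... | false = refl
  ... | true  = contradiction (<ᵇ⇒< m n (subst T (≡.sym m<ᵇn) _)) (<⇒≯ n<m)

edgeIndicator-edge : ∀ {n} {u v : Fin n} (u<v : u Fin.< v) i j →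
  edgeIndicator (edge u<v) i j ≡ (if does (i ≟ u) ∧ does (j ≟ v) then 1 else 0)
edgeIndicator-edge {u = u} {v} u<v i j = cong (if_then 1 else 0) oriented
  where
  oriented : (toℕ i <ᵇ toℕ j) ∧ adj (edge u<v) i j ≡ does (i ≟ u) ∧ does (j ≟ v)
  oriented with i ≟ u | j ≟ v | i ≟ v | j ≟ u
  ... | yes refl | yes refl | _        | _        rewrite <ᵇ-true u<v = refl
  ... | yes refl | no _     | yes refl | _        = contradiction refl (Finₚ.<⇒≢ u<v)
  ... | yes _    | no _     | no _     | _        = ∧-zeroʳ _
  ... | no _     | _        | yes refl | yes refl rewrite <ᵇ-false u<v = refl
  ... | no _     | _        | yes _    | no _     = ∧-zeroʳ _
  ... | no _     | _        | no _     | _        = ∧-zeroʳ _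

edgeCount-edge : ∀ {n} {u v : Fin n} (u<v : u Fin.< v) → edgeCount (edge u<v) ≡ 1
edgeCount-edge {n} {u} {v} u<v = begin
  edgeCount (edge u<v)
    ≡⟨ edgeCount-pointwise (edge u<v) (edgeIndicator-edge u<v) ⟩
  ∑[ i < n ] ∑[ j < n ] (if does (i ≟ u) ∧ does (j ≟ v) then 1 else 0)
    ≡⟨ sum-cong-≗ row ⟩
  ∑[ i < n ] δ u i
    ≡⟨ ∑-δ u ⟩
  1 ∎
  where
  open ≡-Reasoning
  row : ∀ i → ∑[ j < n ] (if does (i ≟ u) ∧ does (j ≟ v) then 1 else 0) ≡ δ u i
  row i with i ≟ u
  ... | yes _ = ∑-δ v
  ... | no _  = sum-replicate-zero n

-- Domination number

∣p∪q∣≤∣p∣+∣q∣ : ∀ {n} (p q : Subset n) → ∣ p ∪ q ∣ ≤ ∣ p ∣ + ∣ q ∣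
∣p∪q∣≤∣p∣+∣q∣ []            []            = z≤n
∣p∪q∣≤∣p∣+∣q∣ (inside  ∷ p) (inside  ∷ q) =
  s≤s (≤-trans (∣p∪q∣≤∣p∣+∣q∣ p q) (+-monoʳ-≤ ∣ p ∣ (n≤1+n ∣ q ∣)))
∣p∪q∣≤∣p∣+∣q∣ (inside  ∷ p) (outside ∷ q) = s≤s (∣p∪q∣≤∣p∣+∣q∣ p q)
∣p∪q∣≤∣p∣+∣q∣ (outside ∷ p) (inside  ∷ q) =
  ≤-trans (s≤s (∣p∪q∣≤∣p∣+∣q∣ p q)) (≤-reflexive (≡.sym (+-suc ∣ p ∣ ∣ q ∣)))
∣p∪q∣≤∣p∣+∣q∣ (outside ∷ p) (outside ∷ q) = ∣p∪q∣≤∣p∣+∣q∣ p q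

Dominating-mono : ∀ {n} {H G : Graph n} {D} → H ⊆E G → Dominating H D → Dominating G D
Dominating-mono H⊆G dom v with dom v
... | inj₁ v∈D              = inj₁ v∈D
... | inj₂ (u , u∈D , uv∈H) = inj₂ (u , u∈D , H⊆G u v uv∈H)

Dominating-─ : ∀ {n} {H A : Graph n} {D D′ : Subset n} → Dominating H D → D ⊆ D′ →
  (∀ x w → adj A x w ≡ true → x ∈ D → w ∈ D′) → Dominating (H ─ A) D′
Dominating-─ {H = H} {A} dom D⊆D′ covers w with dom w
... | inj₁ w∈D = inj₁ (D⊆D′ w∈D)
... | inj₂ (x , x∈D , xw∈H) with adj A x w in xw∈A
...   | true  = inj₁ (covers x w xw∈A x∈D)
...   | false = inj₂ (x , D⊆D′ x∈D , trans (cong (λ b → adj H x w ∧ not b) xw∈A)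
                                           (trans (∧-identityʳ (adj H x w)) xw∈H))

dominating? : ∀ {n} (G : Graph n) (D : Subset n) → Dec (Dominating G D)
dominating? G D = Finₚ.all? λ v → (v ∈? D) ⊎-dec Finₚ.any? λ u → (u ∈? D) ×-dec (adj G u v ≟ᵇ true)

least-upward-closed : (P : ℕ → Set) → (∀ k → Dec (P k)) → (∀ {j k} → j ≤ k → P j → P k) →
  ∀ {m} → P m → ∃[ k ] P k × (∀ j → P j → k ≤ j)
least-upward-closed P P? up {zero}  p0 = 0 , p0 , λ _ _ → z≤n
least-upward-closed P P? up {suc m} pm with P? m
... | yes pm′ = least-upward-closed P P? up pm′
... | no ¬pm′ = suc m , pm , λ j pj → ≰⇒> (λ j≤m → ¬pm′ (up j≤m pj))

domNum-exists : ∀ {n} (G : Graph n) → ∃ (IsDomNum G)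
domNum-exists G =
  fromLeast (least-upward-closed Bounded Bounded? widen (⊤ , (λ _ → inj₁ ∈⊤) , ≤-refl))
  where
  Bounded : ℕ → Set
  Bounded k = ∃[ D ] Dominating G D × ∣ D ∣ ≤ k
  Bounded? : ∀ k → Dec (Bounded k)
  Bounded? k = anySubset? λ D → dominating? G D ×-dec (∣ D ∣ ≤? k)
  widen : ∀ {j k} → j ≤ k → Bounded j → Bounded k
  widen j≤k (D , dom , ∣D∣≤j) = D , dom , ≤-trans ∣D∣≤j j≤k
  fromLeast : ∃[ k ] Bounded k × (∀ j → Bounded j → k ≤ j) → ∃ (IsDomNum G)
  fromLeast (k , (D , dom , ∣D∣≤k) , least) =
    k , (D , dom , ≤-antisym ∣D∣≤k (least ∣ D ∣ (D , dom , ≤-refl))) ,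
    λ D′ dom′ → least ∣ D′ ∣ (D′ , dom′ , ≤-refl)

-- Opaque, so that unification never unfolds the exhaustive search defining γ.
opaque
  γ : ∀ {n} → Graph n → ℕ
  γ G = proj₁ (domNum-exists G)

  γ-isDomNum : ∀ {n} (G : Graph n) → IsDomNum G (γ G)
  γ-isDomNum G = proj₂ (domNum-exists G)

IsDomNum⇒≡γ : ∀ {n} {G : Graph n} {k} → IsDomNum G k → k ≡ γ G
IsDomNum⇒≡γ {G = G} ((D , dom , ∣D∣≡k) , minimal) with γ-isDomNum G
... | (D′ , dom′ , ∣D′∣≡γ) , minimal′ =
  ≤-antisym (subst (_ ≤_) ∣D′∣≡γ (minimal D′ dom′)) (subst (_ ≤_) ∣D∣≡k (minimal′ D dom))

γ-cong : ∀ {n} {A B : Graph n} → A ≈G B → γ A ≡ γ B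
γ-cong {A = A} {B} A≈B with γ-isDomNum A
... | (D , dom , ∣D∣≡γ) , minimal = IsDomNum⇒≡γ {G = B}
  ( (D , Dominating-mono {H = A} {B} (≈G⇒⊆E {A = A} {B} A≈B) dom , ∣D∣≡γ)
  , λ D′ dom′ → minimal D′
      (Dominating-mono {H = B} {A} (≈G⇒⊆E {A = B} {A} λ i j → ≡.sym (A≈B i j)) dom′))

Dominating-─-edge : ∀ {n} {H : Graph n} {D : Subset n} {u v : Fin n} (u<v : u Fin.< v) →
  Dominating H D → ∃[ z ] Dominating (H ─ edge u<v) (D ∪ ⁅ z ⁆)
Dominating-─-edge {H = H} {D} {u} {v} u<v dom with u ∈? D
... | yes u∈D = v , Dominating-─ {H = H} {edge u<v} dom (p⊆p∪q ⁅ v ⁆)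
                      λ x w xw∈e _ → covered (edge-endpoints u<v x w xw∈e)
  where
  covered : ∀ {x w} → (x ≡ u × w ≡ v) ⊎ (x ≡ v × w ≡ u) → w ∈ D ∪ ⁅ v ⁆
  covered (inj₁ (_ , refl)) = x∈p∪q⁺ (inj₂ (x∈⁅x⁆ v))
  covered (inj₂ (_ , refl)) = x∈p∪q⁺ (inj₁ u∈D)
... | no u∉D = u , Dominating-─ {H = H} {edge u<v} dom (p⊆p∪q ⁅ u ⁆)
                     λ x w xw∈e x∈D → covered x∈D (edge-endpoints u<v x w xw∈e)
  where
  covered : ∀ {x w} → x ∈ D → (x ≡ u × w ≡ v) ⊎ (x ≡ v × w ≡ u) → w ∈ D ∪ ⁅ u ⁆
  covered x∈D (inj₁ (refl , _)) = contradiction x∈D u∉D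
  covered _   (inj₂ (_ , refl)) = x∈p∪q⁺ (inj₂ (x∈⁅x⁆ u))

γ-─-edge : ∀ {n} (H : Graph n) {u v : Fin n} (u<v : u Fin.< v) → γ (H ─ edge u<v) ≤ suc (γ H)
γ-─-edge H u<v with γ-isDomNum H | γ-isDomNum (H ─ edge u<v)
... | (D , dom , ∣D∣≡γ) , _ | _ , minimal with Dominating-─-edge {H = H} u<v dom
...   | z , dom′ = begin
  γ (H ─ edge u<v)    ≤⟨ minimal (D ∪ ⁅ z ⁆) dom′ ⟩
  ∣ D ∪ ⁅ z ⁆ ∣       ≤⟨ ∣p∪q∣≤∣p∣+∣q∣ D ⁅ z ⁆ ⟩
  ∣ D ∣ + ∣ ⁅ z ⁆ ∣   ≡⟨ cong₂ _+_ ∣D∣≡γ (∣⁅x⁆∣≡1 z) ⟩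
  γ H + 1             ≡⟨ +-comm (γ H) 1 ⟩
  suc (γ H)           ∎
  where open ≤-Reasoning

record Edge {n} (F : Graph n) : Set where
  constructor mkEdge
  field
    {u v} : Fin n
    u<v   : u Fin.< v
    uv∈F  : adj F u v ≡ true

edgeOf : ∀ {n} {F : Graph n} → Edge F → Graph n
edgeOf (mkEdge u<v _) = edge u<v

edgeOf-⊆E : ∀ {n} {F : Graph n} (e : Edge F) → edgeOf e ⊆E F
edgeOf-⊆E {F = F} (mkEdge {u} {v} u<v uv∈F) i j ij∈e with edge-endpoints u<v i j ij∈e
... | inj₁ (refl , refl) = uv∈F
... | inj₂ (refl , refl) = trans (sym F v u) uv∈F

edgeCount-edgeOf : ∀ {n} {F : Graph n} (e : Edge F) → edgeCount (edgeOf e) ≡ 1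
edgeCount-edgeOf (mkEdge u<v _) = edgeCount-edge u<v

edge-or-empty : ∀ {n} (F : Graph n) → Edge F ⊎ (∀ u v → adj F u v ≡ false)
edge-or-empty F with Finₚ.any? (λ u → Finₚ.any? λ v → adj F u v ≟ᵇ true)
... | no no-edge = inj₂ λ u v → ¬-not λ uv∈F → no-edge (u , v , uv∈F)
... | yes (u , v , uv∈F) with Finₚ.<-cmp u v
...   | tri< u<v _ _  = inj₁ (mkEdge u<v uv∈F)
...   | tri≈ _ refl _ = contradiction (trans (≡.sym (irrefl F u)) uv∈F) λ ()
...   | tri> _ _ v<u  = inj₁ (mkEdge v<u (trans (sym F v u) uv∈F))

γ<γ─⇒Edge : ∀ {n} {G F : Graph n} → γ G < γ (G ─ F) → Edge F
γ<γ─⇒Edge {G = G} {F} γ<γ─ with edge-or-empty F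
... | inj₁ e     = e
... | inj₂ empty = contradiction (γ-cong {A = G ─ F} {G} G─F≈G) (>⇒≢ γ<γ─)
  where
  G─F≈G : (G ─ F) ≈G G
  G─F≈G i j = trans (cong (λ b → adj G i j ∧ not b) (empty i j)) (∧-identityʳ (adj G i j))

edgeCount-─-edgeOf : ∀ {n} {F : Graph n} (e : Edge F) → edgeCount F ≡ suc (edgeCount (F ─ edgeOf e))
edgeCount-─-edgeOf {F = F} e = begin
  edgeCount F
    ≡⟨ edgeCount-cong {A = F} {F₀ ∪G edgeOf e} (≈G-─∪ {F = F} {A = edgeOf e} (edgeOf-⊆E e)) ⟩
  edgeCount (F₀ ∪G edgeOf e)
    ≡⟨ edgeCount-∪ {A = F₀} {B = edgeOf e} (─-disjoint F (edgeOf e)) ⟩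
  edgeCount F₀ + edgeCount (edgeOf e)
    ≡⟨ cong (edgeCount F₀ +_) (edgeCount-edgeOf e) ⟩
  edgeCount F₀ + 1
    ≡⟨ +-comm (edgeCount F₀) 1 ⟩
  suc (edgeCount F₀) ∎
  where
  open ≡-Reasoning
  F₀ = F ─ edgeOf e

γ-─-edgeOf : ∀ {n} (G : Graph n) {F : Graph n} (e : Edge F) →
  γ (G ─ F) ≤ suc (γ (G ─ (F ─ edgeOf e)))
γ-─-edgeOf G {F} e@(mkEdge u<v _) = subst (_≤ suc (γ (G ─ F₀)))
  (≡.sym (γ-cong {A = G ─ F} {(G ─ F₀) ─ edgeOf e} (─≈─-─ {F = F} {A = edgeOf e} (edgeOf-⊆E e) G)))
  (γ-─-edge (G ─ F₀) u<v)
  where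
  F₀ = F ─ edgeOf e

-- Bondage sets

IsBondageSet⁺ : ∀ {n} {G F : Graph n} → F ⊆E G → γ G < γ (G ─ F) → IsBondageSet G F
IsBondageSet⁺ {G = G} {F} F⊆G γ<γ─ = F⊆G , γ G , γ (G ─ F) , γ-isDomNum G , γ-isDomNum (G ─ F) , γ<γ─

IsBondageSet⇒γ< : ∀ {n} {G F : Graph n} → IsBondageSet G F → γ G < γ (G ─ F)
IsBondageSet⇒γ< {G = G} {F} (_ , _ , _ , dk , dk′ , k<k′) =
  subst₂ _<_ (IsDomNum⇒≡γ {G = G} dk) (IsDomNum⇒≡γ {G = G ─ F} dk′) k<k′

IsSyncBondageSet⁺ : ∀ {n} {G F : Graph n} {k} → F ⊆E G → γ (G ─ F) ≡ γ G + k → IsSyncBondageSet k G F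
IsSyncBondageSet⁺ {G = G} {F} F⊆G γ≡ = F⊆G , γ G , γ (G ─ F) , γ-isDomNum G , γ-isDomNum (G ─ F) , γ≡

IsSyncBondageSet⇒γ≡ : ∀ {n} {G F : Graph n} {k} → IsSyncBondageSet k G F → γ (G ─ F) ≡ γ G + k
IsSyncBondageSet⇒γ≡ {G = G} {F} {k} (_ , _ , _ , dg , dg′ , g′≡g+k) =
  trans (≡.sym (IsDomNum⇒≡γ {G = G ─ F} dg′)) (trans g′≡g+k (cong (_+ k) (IsDomNum⇒≡γ {G = G} dg)))

IsBondageSet⇒edgeCount>0 : ∀ {n} {G F : Graph n} → IsBondageSet G F → 0 < edgeCount F
IsBondageSet⇒edgeCount>0 {G = G} {F} bs =
  subst (0 <_) (≡.sym (edgeCount-─-edgeOf (γ<γ─⇒Edge {G = G} {F} (IsBondageSet⇒γ< {G = G} {F} bs)))) z<s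

IsBondageNum⁺-1 : ∀ {n} {G A : Graph n} → IsBondageSet G A → edgeCount A ≡ 1 → IsBondageNum G 1
IsBondageNum⁺-1 {G = G} {A} bs ∣A∣≡1 = (A , bs , ∣A∣≡1) , λ F → IsBondageSet⇒edgeCount>0 {G = G} {F}

IsMinBondageSet⁺ : ∀ {n} {G F : Graph n} {β} → IsBondageNum G β → IsBondageSet G F → edgeCount F ≡ β →
  IsMinBondageSet G F
IsMinBondageSet⁺ (_ , minimal) bs ∣F∣≡β =
  bs , λ F′ bs′ → subst (_≤ edgeCount F′) (≡.sym ∣F∣≡β) (minimal F′ bs′)

IsMinBondageSet⇒edgeCount≡ : ∀ {n} {G F : Graph n} {β} → IsBondageNum G β → IsMinBondageSet G F →
  edgeCount F ≡ β
IsMinBondageSet⇒edgeCount≡ {F = F} ((F₁ , bs₁ , ∣F₁∣≡β) , minimal) (bs , minimum) =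
  ≤-antisym (subst (edgeCount F ≤_) ∣F₁∣≡β (minimum F₁ bs₁)) (minimal F bs)

-- Dropping one edge from a minimum bondage set leaves a set that is not a bondage set.
minBondageSet-γ : ∀ {n} {G F : Graph n} {β} → IsBondageNum G β → IsBondageSet G F → edgeCount F ≡ β →
  γ (G ─ F) ≡ γ G + 1
minBondageSet-γ {G = G} {F} {β} (_ , minimal) bs@(F⊆G , _) ∣F∣≡β =
  trans (≤-antisym γ─≤ (IsBondageSet⇒γ< {G = G} {F} bs)) (+-comm 1 (γ G))
  where
  e : Edge F
  e = γ<γ─⇒Edge {G = G} (IsBondageSet⇒γ< {G = G} {F} bs)
  F₀ = F ─ edgeOf e
  F₀⊆G : F₀ ⊆E G
  F₀⊆G = ⊆E-trans {A = F₀} {F} {G} (─-⊆E F (edgeOf e)) F⊆G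
  F₀-not-bondage : ¬ γ G < γ (G ─ F₀)
  F₀-not-bondage γ<γ─F₀ = n≮n (edgeCount F₀)
    (subst (_≤ edgeCount F₀) (trans (≡.sym ∣F∣≡β) (edgeCount-─-edgeOf e))
           (minimal F₀ (IsBondageSet⁺ {G = G} {F₀} F₀⊆G γ<γ─F₀)))
  γ─≤ : γ (G ─ F) ≤ suc (γ G)
  γ─≤ = ≤-trans (γ-─-edgeOf G e) (s≤s (≮⇒≥ F₀-not-bondage))

IsSyncBondageSet-∪ : ∀ {n} {G F F′ : Graph n} {k l} → F ⊆E G → F′ ⊆E (G ─ F) →
  γ (G ─ F) ≡ γ G + k → γ ((G ─ F) ─ F′) ≡ γ (G ─ F) + l → IsSyncBondageSet (k + l) G (F ∪G F′)
IsSyncBondageSet-∪ {G = G} {F} {F′} {k} {l} F⊆G F′⊆G─F γ₁ γ₂ =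
  IsSyncBondageSet⁺ {G = G} {F ∪G F′} (∪-⊆E {G = G} {F} {F′} F⊆G F′⊆G─F) (begin
    γ (G ─ (F ∪G F′))    ≡⟨ γ-cong {A = (G ─ F) ─ F′} {G ─ (F ∪G F′)} (─-─≈─∪ G F F′) ⟨
    γ ((G ─ F) ─ F′)     ≡⟨ γ₂ ⟩
    γ (G ─ F) + l        ≡⟨ cong (_+ l) γ₁ ⟩
    γ G + k + l          ≡⟨ +-assoc (γ G) k l ⟩
    γ G + (k + l)        ∎)
  where open ≡-Reasoning

syncBondage₂-witness : ∀ {n} {G : Graph n} {β c} → IsBondageNum G β → IsBondageNumMB G c →
  ∃[ F ] IsSyncBondageSet 2 G F × edgeCount F ≡ β + c
syncBondage₂-witness {G = G} bG
  ((F , minF@(bsF@(F⊆G , _) , _) , bGF@((F′ , bsF′@(F′⊆G─F , _) , ∣F′∣≡c) , _)) , _) =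
  F ∪G F′ ,
  IsSyncBondageSet-∪ {G = G} {F} {F′} F⊆G F′⊆G─F
    (minBondageSet-γ {G = G} {F} bG bsF ∣F∣≡β) (minBondageSet-γ {G = G ─ F} {F′} bGF bsF′ ∣F′∣≡c) ,
  trans (edgeCount-∪ {A = F} {F′} (⊆E-─⇒disjoint {G = G} {F} {F′} F′⊆G─F)) (cong₂ _+_ ∣F∣≡β ∣F′∣≡c)
  where
  ∣F∣≡β = IsMinBondageSet⇒edgeCount≡ {G = G} {F} bG minF

syncBondage₂-split : ∀ {n} {G F : Graph n} {β} → IsBondageNum G β → IsSyncBondageSet 2 G F →
  suc (suc β) ≤ edgeCount F
  ⊎ ∃[ F₀ ] IsMinBondageSet G F₀ × IsBondageNum (G ─ F₀) 1 × edgeCount F ≡ suc β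
syncBondage₂-split {G = G} {F} {β} bG@(_ , minimal) sbs@(F⊆G , _) =
  split (m≤n⇒m<n∨m≡n (minimal F₀ bs₀))
  where
  γF≡ : γ (G ─ F) ≡ γ G + 2
  γF≡ = IsSyncBondageSet⇒γ≡ {G = G} {F} sbs
  e : Edge F
  e = γ<γ─⇒Edge {G = G} (subst (γ G <_) (≡.sym γF≡) (m<m+n (γ G) z<s))
  F₀ = F ─ edgeOf e
  ∣F∣≡ : edgeCount F ≡ suc (edgeCount F₀)
  ∣F∣≡ = edgeCount-─-edgeOf e
  bs₀ : IsBondageSet G F₀
  bs₀ = IsBondageSet⁺ {G = G} {F₀} (⊆E-trans {A = F₀} {F} {G} (─-⊆E F (edgeOf e)) F⊆G) (s≤s⁻¹ (begin
    suc (suc (γ G))    ≡⟨ +-comm 2 (γ G) ⟩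
    γ G + 2            ≡⟨ γF≡ ⟨
    γ (G ─ F)          ≤⟨ γ-─-edgeOf G e ⟩
    suc (γ (G ─ F₀))   ∎))
    where open ≤-Reasoning
  edge-bondage : edgeCount F₀ ≡ β → IsBondageSet (G ─ F₀) (edgeOf e)
  edge-bondage ∣F₀∣≡β = IsBondageSet⁺ {G = G ─ F₀} {edgeOf e}
    (⊆E-─-─ {F = F} {A = edgeOf e} (edgeOf-⊆E e) {G} F⊆G) (begin-strict
    γ (G ─ F₀)                 ≡⟨ minBondageSet-γ {G = G} {F₀} bG bs₀ ∣F₀∣≡β ⟩
    γ G + 1                    <⟨ +-monoʳ-< (γ G) (n<1+n 1) ⟩
    γ G + 2                    ≡⟨ γF≡ ⟨
    γ (G ─ F)                  ≡⟨ γ-cong {A = G ─ F} {(G ─ F₀) ─ edgeOf e}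
                                    (─≈─-─ {F = F} {A = edgeOf e} (edgeOf-⊆E e) G) ⟩
    γ ((G ─ F₀) ─ edgeOf e)    ∎)
    where open ≤-Reasoning
  split : β < edgeCount F₀ ⊎ β ≡ edgeCount F₀ →
    suc (suc β) ≤ edgeCount F
    ⊎ ∃[ F₀ ] IsMinBondageSet G F₀ × IsBondageNum (G ─ F₀) 1 × edgeCount F ≡ suc β
  split (inj₁ β<∣F₀∣) = inj₁ (subst (suc (suc β) ≤_) (≡.sym ∣F∣≡) (s≤s β<∣F₀∣))
  split (inj₂ β≡∣F₀∣) = inj₂
    ( F₀
    , IsMinBondageSet⁺ {G = G} {F₀} bG bs₀ (≡.sym β≡∣F₀∣)
    , IsBondageNum⁺-1 {G = G ─ F₀} {edgeOf e} (edge-bondage (≡.sym β≡∣F₀∣)) (edgeCount-edgeOf e)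
    , trans ∣F∣≡ (cong suc (≡.sym β≡∣F₀∣)) )

theorem1 : ∀ (n : ℕ) (G : Graph n) (g β c : ℕ) →
    IsDomNum G g → g + 2 ≤ n →
    IsBondageNum G β → IsBondageNumMB G c → c ≤ 2 →
    IsSyncBondageNum 2 G (β + c)
theorem1 n G g β c _ _ bG bMB@(_ , minimalMB) c≤2 = syncBondage₂-witness {G = G} bG bMB , lower
  where
  lower : ∀ F → IsSyncBondageSet 2 G F → β + c ≤ edgeCount F
  lower F sbs with syncBondage₂-split {G = G} {F} bG sbs
  ... | inj₁ β+2≤∣F∣ = ≤-trans (+-monoʳ-≤ β c≤2) (subst (_≤ edgeCount F) (+-comm 2 β) β+2≤∣F∣)
  ... | inj₂ (F₀ , minF₀ , bF₀≡1 , ∣F∣≡β+1) =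
    subst (β + c ≤_) (trans (+-comm β 1) (≡.sym ∣F∣≡β+1)) (+-monoʳ-≤ β (minimalMB F₀ minF₀ 1 bF₀≡1))
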